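{- Let $\phi_{\mathrm{xor}}$ be a conjunction of xor-constraints, $X\subseteq\mathrm{vars}(\phi_{\mathrm{xor}})$, and $(V_a,V_b)$ an $X$-cut partition of $\phi_{\mathrm{xor}}$. Let $\phi^{a}=\bigwedge_{D\in V_a}D$, $\phi^{b}=\bigwedge_{D\in V_b}D$, and let $l_1,\dots,l_k$ be literals over $\mathrm{vars}(\phi_{\mathrm{xor}})$. Then: (1) If $\phi_{\mathrm{xor}}\land l_1\land\dots\land l_k$ is unsatisfiable, then either $\phi^{a}\land l_1\land\dots\land l_k$ or $\phi^{b}\land l_1\land\dots\land l_k$ is unsatisfiable; or $\phi^{a}\land l_1\land\dots\land l_k\models(X'\equiv p')$ and $\phi^{b}\land l_1\land\dots\land l_k\models(X'\equiv p'\oplus\top)$ for some $X'\subseteq X$ and $p'\in\{\top,\bot\}$. (2) If $\phi_{\mathrm{xor}}\land l_1\land\dots\land l_k$ is satisfiable and $\phi_{\mathrm{xor}}\land l_1\land\dots\land l_k\models(Y\equiv p)$ for some $p\in\{\top,\bot\}$ and some $Y\subseteq\mathrm{vars}(\phi^{\alpha})$ with $Y\cap(\mathrm{vars}(\phi^{\beta})\setminus\mathrm{vars}(\phi^{\alpha}))=\emptyset$, where $\alpha\in\{a,b\}$ and $\beta$ is the other element of $\{a,b\}$, then either $\phi^{a}\land l_1\land\dots\land l_k\models(Y\equiv p)$ or $\phi^{b}\land l_1\land\dots\land l_k\models(Y\equiv p)$; or $\phi^{\alpha}\land l_1\land\dots\land l_k\models(X'\equiv p')$ and $\phi^{\beta}\land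 l_1\land\dots\land l_k\land(X'\equiv p')\models(Y\equiv p)$ for some $X'\subseteq X$, $p'\in\{\top,\bot\}$, $\alpha\in\{a,b\}$ and $\beta\in\{a,b\}\setminus\{\alpha\}$.
   Context: An xor-constraint is an equation $x_1\oplus\dots\oplus x_n\equiv p$ with Boolean variables and $p\in\{\bot,\top\}$; a literal $x$ (resp. $\neg x$) is identified with $x\equiv\top$ (resp. $x\equiv\bot$). For a set of variables $Z=\{z_1,\dots,z_n\}$, $(Z\equiv p)$ denotes $(z_1\oplus\dots\oplus z_n\equiv p)$. For a set $S$ of xor-constraints, $\mathrm{vars}(S)$ is the set of variables occurring in them. Given a conjunction $\phi_{\mathrm{xor}}$ of xor-constraints and $X\subseteq\mathrm{vars}(\phi_{\mathrm{xor}})$, an $X$-cut partition of $\phi_{\mathrm{xor}}$ is a partition $(V_a,V_b)$ of the set of xor-constraints of $\phi_{\mathrm{xor}}$ with $\mathrm{vars}(V_a)\cap\mathrm{vars}(V_b)=X$. -}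

module Defs where

open import Data.Nat using (ℕ; zero; suc)
open import Data.Bool using (Bool; true; false; _xor_; _∧_; not)
open import Data.Fin using (Fin; zero; suc)
open import Data.Fin.Subset using (Subset; ⁅_⁆; ⋃)
open import Data.Vec using (Vec; []; _∷_)
open import Data.List using (List; map; _++_; [_])
open import Data.List.Relation.Unary.All using (All)
open import Data.Product using (_×_; _,_; proj₁; proj₂; ∃)
open import Relation.Binary.PropositionalEquality using (_≡_)

-- Variables are  Fin n ; truth values are Bool with  true = ⊤ , false = ⊥ .
-- An xor-constraint  (Z ≡ p)  : a set Z of variables and a parity p.
record XorConstraint (n : ℕ) : Set where
  constructor _≡ₓ_
  field
    scope  : Subset n
    parity : Bool
open XorConstraint public

Formula : ℕ → Set
Formula n = List (XorConstraint n)

Assignment : ℕ → Set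
Assignment n = Fin n → Bool

xorSum : ∀ {n} → Subset n → Assignment n → Bool
xorSum []          σ = false
xorSum (b ∷ Z) σ = (b ∧ σ zero) xor xorSum Z (λ i → σ (suc i))

_⊨ᶜ_ : ∀ {n} → Assignment n → XorConstraint n → Set
σ ⊨ᶜ (Z ≡ₓ p) = xorSum Z σ ≡ p

_⊨_ : ∀ {n} → Assignment n → Formula n → Set
σ ⊨ φ = All (σ ⊨ᶜ_) φ

Satisfiable : ∀ {n} → Formula n → Set
Satisfiable {n} φ = ∃ λ (σ : Assignment n) → σ ⊨ φ

Unsatisfiable : ∀ {n} → Formula n → Set
Unsatisfiable φ = Satisfiable φ → Data.Empty.⊥
  where import Data.Empty

_Entails_ : ∀ {n} → Formula n → XorConstraint n → Set
φ Entails D = ∀ σ → σ ⊨ φ → σ ⊨ᶜ D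

vars : ∀ {n} → Formula n → Subset n
vars φ = ⋃ (map scope φ)

-- A literal: variable together with polarity; x is (x ≡ ⊤), ¬x is (x ≡ ⊥).
Literal : ℕ → Set
Literal n = Fin n × Bool

litConstraint : ∀ {n} → Literal n → XorConstraint n
litConstraint (x , b) = ⁅ x ⁆ ≡ₓ b

lits : ∀ {n} → List (Literal n) → Formula n
lits ls = map litConstraint ls

data Side : Set where
  a b : Side

other : Side → Side
other a = b
other b = a

part : ∀ {n} → Formula n → Formula n → Side → Formula n
part Va Vb a = Va
part Va Vb b = Vb

module Submission where

-- Identify an assignment with a point of 𝔽₂ⁿ (a Boolean vector); an
-- xor-constraint (Z ≡ p) says that the linear functional Z · v equals p, so
-- the models of a conjunction of xor-constraints form an AFFINE set (closed
-- under u ⊕ v ⊕ w).  The key linear-algebra fact is SEPARATION: a decidable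
-- affine set avoiding the origin lies in a hyperplane c · s = 1.  Applied to
-- the restrictions to X of differences u ⊕ w, it shows that two affine sets
-- A, B either contain points agreeing on X, or are separated by the parity
-- of some X′ ⊆ X.  Models of P ∧ l⃗ and Q ∧ l⃗ agreeing on the shared
-- variables glue to a model of P ∧ Q ∧ l⃗.  Part (1) separates the models of
-- Vᵃ ∧ l⃗ and Vᵇ ∧ l⃗; part (2) those of φ^α ∧ l⃗ ∧ (Y ≡ ¬p) and φ^β ∧ l⃗.

open import Defs
open import Data.Bool using (Bool; true; false; not)
open import Data.Fin.Subset using (Subset; _⊆_; _∩_; _─_; ⊥; _∈_)
open import Data.List using (List; _++_; [_])
open import Data.List.Relation.Unary.All using (All)
open import Data.List.Relation.Binary.Permutation.Propositional using (_↭_)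
open import Data.Product using (_×_; _,_; proj₁; Σ; ∃)
open import Data.Sum using (_⊎_)
open import Relation.Binary.PropositionalEquality using (_≡_)

open import Algebra.Bundles using (CommutativeRing)
open import Data.Bool using (_xor_; _∧_)
open import Data.Bool.Properties
  using (∧-assoc; ∧-distribˡ-xor; ∧-identityʳ; ∧-zeroʳ; xor-same; xor-inverseˡ;
         xor-∧-commutativeRing; not-injective; not-¬; ¬-not)
  renaming (_≟_ to _≟ᵇ_)
import Data.Nat as ℕ
open import Data.Fin.Subset using (⁅_⁆)
open import Data.Fin.Subset.Properties
  using (_∈?_; anySubset?; p∩q⊆q; p⊆p∪q; q⊆p∪q; x∈⁅y⁆⇒x≡y; x∈p∩q⁺; ∩-comm; ⊆-reflexive)
open import Data.Empty using (⊥-elim)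
open import Data.List using ([]; _∷_)
open import Data.List.Properties using (++-assoc)
open import Data.List.Relation.Unary.All using ([]; _∷_; all?)
open import Data.List.Relation.Unary.All.Properties using (++⁺; ++⁻)
open import Data.List.Relation.Binary.Permutation.Propositional
  using (↭-sym; ↭-trans; ↭-reflexive)
open import Data.List.Relation.Binary.Permutation.Propositional.Properties
  using (All-resp-↭; ++⁺ʳ; ++-comm)
open import Data.Product using (proj₂; ∃₂)
open import Data.Sum using (inj₁; inj₂; [_,_]′)
open import Function using (_∘_)
open import Data.Vec using (Vec; []; _∷_; head; tail; lookup; tabulate; zipWith; here; there)
open import Data.Vec.Properties using (≡-dec; lookup∘tabulate; zipWith-distribˡ)
open import Relation.Nullary using (yes; no; ¬_)
open import Relation.Nullary.Decidable using (_×-dec_)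
open import Relation.Unary using (Decidable)
open import Relation.Binary.PropositionalEquality
  using (refl; sym; trans; cong; cong₂; subst; module ≡-Reasoning)
import Algebra.Properties.CommutativeSemigroup as CommutativeSemigroupProperties

infixl 6 _⊕_
_⊕_ : ∀ {m} → Vec Bool m → Vec Bool m → Vec Bool m
_⊕_ = zipWith _xor_

infix 7 _·_
_·_ : ∀ {m} → Subset m → Vec Bool m → Bool
Z · v = xorSum Z (lookup v)

xor-interchange : ∀ x y z t → (x xor y) xor (z xor t) ≡ (x xor z) xor (y xor t)
xor-interchange = CommutativeSemigroupProperties.interchange
                    (CommutativeRing.+-commutativeSemigroup xor-∧-commutativeRing)

⊕-interchange : ∀ {m} (u v w z : Vec Bool m) → (u ⊕ v) ⊕ (w ⊕ z) ≡ (u ⊕ w) ⊕ (v ⊕ z)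
⊕-interchange []       []       []       []       = refl
⊕-interchange (x ∷ u) (y ∷ v) (x′ ∷ w) (y′ ∷ z) =
  cong₂ _∷_ (xor-interchange x y x′ y′) (⊕-interchange u v w z)

∩-distribˡ-⊕ : ∀ {m} (X u v : Vec Bool m) → X ∩ (u ⊕ v) ≡ (X ∩ u) ⊕ (X ∩ v)
∩-distribˡ-⊕ = zipWith-distribˡ ∧-distribˡ-xor

·-linear : ∀ {m} (Z u v : Vec Bool m) → Z · (u ⊕ v) ≡ Z · u xor Z · v
·-linear []       []       []       = refl
·-linear (z ∷ Z) (x ∷ u) (y ∷ v) = begin
  (z ∧ (x xor y)) xor Z · (u ⊕ v)
    ≡⟨ cong₂ _xor_ (∧-distribˡ-xor z x y) (·-linear Z u v) ⟩
  ((z ∧ x) xor (z ∧ y)) xor (Z · u xor Z · v)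
    ≡⟨ xor-interchange (z ∧ x) (z ∧ y) (Z · u) (Z · v) ⟩
  ((z ∧ x) xor Z · u) xor ((z ∧ y) xor Z · v)
    ∎
  where open ≡-Reasoning

·-linear₃ : ∀ {m} (Z u v w : Vec Bool m) → Z · (u ⊕ v ⊕ w) ≡ (Z · u xor Z · v) xor Z · w
·-linear₃ Z u v w = trans (·-linear Z (u ⊕ v) w) (cong (_xor Z · w) (·-linear Z u v))

⊥·v≡false : ∀ {m} (v : Vec Bool m) → ⊥ · v ≡ false
⊥·v≡false []      = refl
⊥·v≡false (_ ∷ v) = ⊥·v≡false v

·-restrict : ∀ {m} (c X d : Vec Bool m) → (c ∩ X) · d ≡ c · (X ∩ d)
·-restrict []       []       []       = refl
·-restrict (c ∷ cs) (x ∷ xs) (d ∷ ds) =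
  cong₂ _xor_ (∧-assoc c x d) (·-restrict cs xs ds)

agree-on : ∀ {m} (X u w : Vec Bool m) → X ∩ (u ⊕ w) ≡ ⊥ → ∀ {i} → i ∈ X → lookup u i ≡ lookup w i
agree-on (true ∷ X) (x ∷ u) (y ∷ w) e here        = xor≡false⇒≡ x y (cong head e)
  where
  xor≡false⇒≡ : ∀ x y → x xor y ≡ false → x ≡ y
  xor≡false⇒≡ false false _ = refl
  xor≡false⇒≡ true  true  _ = refl
agree-on (_ ∷ X)    (_ ∷ u) (_ ∷ w) e (there i∈X) = agree-on X u w (cong tail e) i∈X

Affine : ∀ {m} → (Vec Bool m → Set) → Set
Affine S = ∀ u v w → S u → S v → S w → S (u ⊕ v ⊕ w)

separation : ∀ m (S : Vec Bool m → Set) → Decidable S → Affine S → ¬ S ⊥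
  → ∃ λ c → ∀ s → S s → c · s ≡ true
separation ℕ.zero    S S? affine 0∉S = [] , λ { [] s∈S → ⊥-elim (0∉S s∈S) }
separation (ℕ.suc m) S S? affine 0∉S
  with separation m (λ s → S (false ∷ s)) (λ s → S? (false ∷ s))
                    (λ u v w → affine (false ∷ u) (false ∷ v) (false ∷ w)) 0∉S
     | anySubset? (λ s → S? (true ∷ s))
     | anySubset? (λ s → S? (false ∷ s))
... | c , c=1 | no ∄S₁ | _ =
  (false ∷ c) , λ { (false ∷ s) s∈S → c=1 s s∈S ; (true ∷ s) s∈S → ⊥-elim (∄S₁ (s , s∈S)) }
... | c , c=1 | yes _ | no ∄S₀ =
  (true ∷ ⊥) , λ { (false ∷ s) s∈S → ⊥-elim (∄S₀ (s , s∈S))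
                 ; (true ∷ s)  s∈S → cong not (⊥·v≡false s) }
... | c , c=1 | yes (t , t∈S₁) | yes (u , u∈S₀) = (not (c · t) ∷ c) , on-S
  where
  -- On the slice x₀ = 1 the functional c is constant, because s ⊕ t ⊕ u lies in the slice x₀ = 0.
  c-constant : ∀ s → S (true ∷ s) → c · s ≡ c · t
  c-constant s s∈S₁ = xor-true-cancel (c · s) (c · t) (begin
    (c · s xor c · t) xor true   ≡⟨ cong ((c · s xor c · t) xor_) (sym (c=1 u u∈S₀)) ⟩
    (c · s xor c · t) xor c · u  ≡⟨ sym (·-linear₃ c s t u) ⟩
    c · (s ⊕ t ⊕ u)
      ≡⟨ c=1 (s ⊕ t ⊕ u) (affine (true ∷ s) (true ∷ t) (false ∷ u) s∈S₁ t∈S₁ u∈S₀) ⟩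
    true                         ∎)
    where
    open ≡-Reasoning
    xor-true-cancel : ∀ x y → (x xor y) xor true ≡ true → x ≡ y
    xor-true-cancel false false _ = refl
    xor-true-cancel true  true  _ = refl
  on-S : ∀ s → S s → (not (c · t) ∷ c) · s ≡ true
  on-S (false ∷ s) s∈S = trans (cong (_xor c · s) (∧-zeroʳ (not (c · t)))) (c=1 s s∈S)
  on-S (true ∷ s)  s∈S = begin
    (not (c · t) ∧ true) xor c · s   ≡⟨ cong₂ _xor_ (∧-identityʳ (not (c · t))) (c-constant s s∈S) ⟩
    not (c · t) xor c · t            ≡⟨ xor-inverseˡ (c · t) ⟩
    true                             ∎
    where open ≡-Reasoning

restricted-difference-sum : ∀ {m} (X u₁ u₂ u₃ w₁ w₂ w₃ : Vec Bool m)
  → X ∩ (u₁ ⊕ w₁) ⊕ X ∩ (u₂ ⊕ w₂) ⊕ X ∩ (u₃ ⊕ w₃) ≡ X ∩ ((u₁ ⊕ u₂ ⊕ u₃) ⊕ (w₁ ⊕ w₂ ⊕ w₃))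
restricted-difference-sum X u₁ u₂ u₃ w₁ w₂ w₃ = begin
  X ∩ (u₁ ⊕ w₁) ⊕ X ∩ (u₂ ⊕ w₂) ⊕ X ∩ (u₃ ⊕ w₃)
    ≡⟨ cong (_⊕ X ∩ (u₃ ⊕ w₃)) (sym (∩-distribˡ-⊕ X (u₁ ⊕ w₁) (u₂ ⊕ w₂))) ⟩
  X ∩ ((u₁ ⊕ w₁) ⊕ (u₂ ⊕ w₂)) ⊕ X ∩ (u₃ ⊕ w₃)
    ≡⟨ sym (∩-distribˡ-⊕ X ((u₁ ⊕ w₁) ⊕ (u₂ ⊕ w₂)) (u₃ ⊕ w₃)) ⟩
  X ∩ ((u₁ ⊕ w₁) ⊕ (u₂ ⊕ w₂) ⊕ (u₃ ⊕ w₃))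
    ≡⟨ cong (λ d → X ∩ (d ⊕ (u₃ ⊕ w₃))) (⊕-interchange u₁ w₁ u₂ w₂) ⟩
  X ∩ ((u₁ ⊕ u₂) ⊕ (w₁ ⊕ w₂) ⊕ (u₃ ⊕ w₃))
    ≡⟨ cong (X ∩_) (⊕-interchange (u₁ ⊕ u₂) (w₁ ⊕ w₂) u₃ w₃) ⟩
  X ∩ ((u₁ ⊕ u₂ ⊕ u₃) ⊕ (w₁ ⊕ w₂ ⊕ w₃))
    ∎
  where open ≡-Reasoning

RestrictedDifferences : ∀ {m} → (Vec Bool m → Set) → (Vec Bool m → Set) → Subset m
  → Vec Bool m → Set
RestrictedDifferences A B X d = ∃₂ λ u w → (A u × B w) × d ≡ X ∩ (u ⊕ w)

restricted-differences? : ∀ {m} {A B : Vec Bool m → Set} → Decidable A → Decidable B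
  → (X : Subset m) → Decidable (RestrictedDifferences A B X)
restricted-differences? A? B? X d =
  anySubset? λ u → anySubset? λ w → (A? u ×-dec B? w) ×-dec ≡-dec _≟ᵇ_ d (X ∩ (u ⊕ w))

restricted-differences-affine : ∀ {m} {A B : Vec Bool m → Set} → Affine A → Affine B
  → (X : Subset m) → Affine (RestrictedDifferences A B X)
restricted-differences-affine A-affine B-affine X _ _ _
  (u₁ , w₁ , (u₁∈A , w₁∈B) , refl) (u₂ , w₂ , (u₂∈A , w₂∈B) , refl)
  (u₃ , w₃ , (u₃∈A , w₃∈B) , refl) =
  (u₁ ⊕ u₂ ⊕ u₃) , (w₁ ⊕ w₂ ⊕ w₃) ,
  (A-affine u₁ u₂ u₃ u₁∈A u₂∈A u₃∈A , B-affine w₁ w₂ w₃ w₁∈B w₂∈B w₃∈B) ,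
  restricted-difference-sum X u₁ u₂ u₃ w₁ w₂ w₃

-- Proof: separate the restricted differences from the origin.
agree-or-separated : ∀ {m} (A B : Vec Bool m → Set) → Decidable A → Decidable B
  → Affine A → Affine B → (X : Subset m)
  → (∃₂ λ u w → A u × B w × X ∩ (u ⊕ w) ≡ ⊥)
    ⊎ (∃ λ X′ → X′ ⊆ X × (∀ u w → A u → B w → X′ · u xor X′ · w ≡ true))
agree-or-separated {m} A B A? B? A-affine B-affine X with restricted-differences? A? B? X ⊥
... | yes (u , w , (u∈A , w∈B) , 0≡d) = inj₁ (u , w , u∈A , w∈B , sym 0≡d)
... | no 0∉D with separation m _ (restricted-differences? A? B? X)
                    (restricted-differences-affine A-affine B-affine X) 0∉D
...   | c , c=1 = inj₂ ((c ∩ X) , p∩q⊆q c X , separates)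
  where
  separates : ∀ u w → A u → B w → (c ∩ X) · u xor (c ∩ X) · w ≡ true
  separates u w u∈A w∈B = begin
    (c ∩ X) · u xor (c ∩ X) · w   ≡⟨ sym (·-linear (c ∩ X) u w) ⟩
    (c ∩ X) · (u ⊕ w)             ≡⟨ ·-restrict c X (u ⊕ w) ⟩
    c · (X ∩ (u ⊕ w))             ≡⟨ c=1 (X ∩ (u ⊕ w)) (u , w , (u∈A , w∈B) , refl) ⟩
    true                          ∎
    where open ≡-Reasoning

separated-parities : ∀ {m} (A B : Vec Bool m → Set) (X′ a₀ b₀ : Vec Bool m)
  → (∀ u w → A u → B w → X′ · u xor X′ · w ≡ true) → A a₀ → B b₀
  → (∀ u → A u → X′ · u ≡ X′ · a₀) × (∀ w → B w → X′ · w ≡ not (X′ · a₀))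
separated-parities A B X′ a₀ b₀ separates a₀∈A b₀∈B =
  (λ u u∈A → not-injective (trans (sym (opposite (separates u b₀ u∈A b₀∈B)))
                                   (opposite (separates a₀ b₀ a₀∈A b₀∈B)))) ,
  (λ w w∈B → opposite (separates a₀ w a₀∈A w∈B))
  where
  opposite : ∀ {x y} → x xor y ≡ true → y ≡ not x
  opposite {false} {true}  _ = refl
  opposite {true}  {false} _ = refl

Models : ∀ {n} → Formula n → Vec Bool n → Set
Models φ v = lookup v ⊨ φ

models? : ∀ {n} (φ : Formula n) → Decidable (Models φ)
models? φ v = all? (λ D → scope D · v ≟ᵇ parity D) φ

models-affine : ∀ {n} (φ : Formula n) → Affine (Models φ)
models-affine []             _ _ _ []       []       []       = []
models-affine ((Z ≡ₓ p) ∷ φ) u v w (u⊨ ∷ u⊨φ) (v⊨ ∷ v⊨φ) (w⊨ ∷ w⊨φ) =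
  parity-kept ∷ models-affine φ u v w u⊨φ v⊨φ w⊨φ
  where
  open ≡-Reasoning
  parity-kept : Z · (u ⊕ v ⊕ w) ≡ p
  parity-kept = begin
    Z · (u ⊕ v ⊕ w)                 ≡⟨ ·-linear₃ Z u v w ⟩
    (Z · u xor Z · v) xor Z · w     ≡⟨ cong₂ (λ x y → (x xor y) xor Z · w) u⊨ v⊨ ⟩
    (p xor p) xor Z · w             ≡⟨ cong₂ _xor_ (xor-same p) w⊨ ⟩
    p                               ∎

xorSum-cong : ∀ {m} (Z : Subset m) {σ τ : Assignment m}
  → (∀ {i} → i ∈ Z → σ i ≡ τ i) → xorSum Z σ ≡ xorSum Z τ
xorSum-cong []          agree = refl
xorSum-cong (true ∷ Z)  agree = cong₂ _xor_ (agree here) (xorSum-cong Z (λ i∈Z → agree (there i∈Z)))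
xorSum-cong (false ∷ Z) agree = xorSum-cong Z (λ i∈Z → agree (there i∈Z))

⊨ᶜ-local : ∀ {n} (D : XorConstraint n) {σ τ : Assignment n}
  → (∀ {i} → i ∈ scope D → σ i ≡ τ i) → σ ⊨ᶜ D → τ ⊨ᶜ D
⊨ᶜ-local (Z ≡ₓ p) agree σ⊨ = trans (sym (xorSum-cong Z agree)) σ⊨

at-singleton : ∀ {n} {x} {σ τ : Assignment n} → σ x ≡ τ x → ∀ {i} → i ∈ ⁅ x ⁆ → σ i ≡ τ i
at-singleton {x = x} σx≡τx i∈⁅x⁆ with x∈⁅y⁆⇒x≡y x i∈⁅x⁆
... | refl = σx≡τx

⊨-local : ∀ {n} (φ : Formula n) {σ τ : Assignment n}
  → (∀ {i} → i ∈ vars φ → σ i ≡ τ i) → σ ⊨ φ → τ ⊨ φ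
⊨-local []      agree []           = []
⊨-local (D ∷ φ) agree (σ⊨D ∷ σ⊨φ) =
  ⊨ᶜ-local D (λ i∈D → agree (p⊆p∪q (vars φ) i∈D)) σ⊨D ∷
  ⊨-local φ (λ i∈φ → agree (q⊆p∪q (scope D) (vars φ) i∈φ)) σ⊨φ

to-point : ∀ {n} (φ : Formula n) {σ : Assignment n} → σ ⊨ φ → Models φ (tabulate σ)
to-point φ {σ} = ⊨-local φ (λ {i} _ → sym (lookup∘tabulate σ i))

·-tabulate : ∀ {n} (Z : Subset n) (σ : Assignment n) → Z · tabulate σ ≡ xorSum Z σ
·-tabulate Z σ = xorSum-cong Z (λ {i} _ → lookup∘tabulate σ i)

unsat-from-points : ∀ {n} (φ : Formula n) → ¬ ∃ (Models φ) → Unsatisfiable φ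
unsat-from-points φ ∄model (σ , σ⊨φ) = ∄model (tabulate σ , to-point φ σ⊨φ)

entails-from-points : ∀ {n} (φ : Formula n) (Z : Subset n) (p : Bool)
  → (∀ v → Models φ v → Z · v ≡ p) → φ Entails (Z ≡ₓ p)
entails-from-points φ Z p parity σ σ⊨φ =
  trans (sym (·-tabulate Z σ)) (parity (tabulate σ) (to-point φ σ⊨φ))

entails-by-refutation : ∀ {n} (φ : Formula n) (Z : Subset n) (p : Bool)
  → (∀ {σ} → σ ⊨ φ → ¬ (σ ⊨ᶜ (Z ≡ₓ not p))) → φ Entails (Z ≡ₓ p)
entails-by-refutation φ Z p refute σ σ⊨φ with xorSum Z σ ≟ᵇ p
... | yes holds = holds
... | no  fails = ⊥-elim (refute σ⊨φ (¬-not fails))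

module Gluing {n} (P Q : Formula n) (σa σb : Assignment n)
                  (agree : ∀ {i} → i ∈ vars P → i ∈ vars Q → σa i ≡ σb i) where

  glue : Assignment n
  glue i with i ∈? vars P
  ... | yes _ = σa i
  ... | no  _ = σb i

  glue-on-P : ∀ {i} → i ∈ vars P → glue i ≡ σa i
  glue-on-P {i} i∈P with i ∈? vars P
  ... | yes _   = refl
  ... | no  i∉P = ⊥-elim (i∉P i∈P)

  glue-off-P : ∀ {i} → ¬ i ∈ vars P → glue i ≡ σb i
  glue-off-P {i} i∉P with i ∈? vars P
  ... | yes i∈P = ⊥-elim (i∉P i∈P)
  ... | no  _   = refl

  glue-on-Q : ∀ {i} → i ∈ vars Q → glue i ≡ σb i
  glue-on-Q {i} i∈Q with i ∈? vars P
  ... | yes i∈P = agree i∈P i∈Q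
  ... | no  _   = refl

  glue-literal : ∀ l → σa ⊨ᶜ litConstraint l → σb ⊨ᶜ litConstraint l → glue ⊨ᶜ litConstraint l
  glue-literal (x , p) σa⊨l σb⊨l with x ∈? vars P
  ... | yes x∈P = ⊨ᶜ-local (litConstraint (x , p)) (at-singleton (sym (glue-on-P x∈P))) σa⊨l
  ... | no  x∉P = ⊨ᶜ-local (litConstraint (x , p)) (at-singleton (sym (glue-off-P x∉P))) σb⊨l

  glue-lits : ∀ ls → σa ⊨ lits ls → σb ⊨ lits ls → glue ⊨ lits ls
  glue-lits []       []            []            = []
  glue-lits (l ∷ ls) (σa⊨l ∷ σa⊨ls) (σb⊨l ∷ σb⊨ls) =
    glue-literal l σa⊨l σb⊨l ∷ glue-lits ls σa⊨ls σb⊨ls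

  glue-⊨ : ∀ ls → σa ⊨ (P ++ lits ls) → σb ⊨ (Q ++ lits ls) → glue ⊨ (P ++ Q ++ lits ls)
  glue-⊨ ls σa⊨ σb⊨ with ++⁻ P σa⊨ | ++⁻ Q σb⊨
  ... | σa⊨P , σa⊨ls | σb⊨Q , σb⊨ls =
    ++⁺ (⊨-local P (λ i∈P → sym (glue-on-P i∈P)) σa⊨P)
        (++⁺ (⊨-local Q (λ i∈Q → sym (glue-on-Q i∈Q)) σb⊨Q) (glue-lits ls σa⊨ls σb⊨ls))

glue-points : ∀ {n} (P Q : Formula n) (ls : List (Literal n)) {X : Subset n}
  → vars P ∩ vars Q ⊆ X → {u w : Vec Bool n}
  → Models (P ++ lits ls) u → Models (Q ++ lits ls) w → X ∩ (u ⊕ w) ≡ ⊥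
  → ∃ λ σ → σ ⊨ (P ++ Q ++ lits ls) × (∀ {i} → i ∈ vars P → σ i ≡ lookup u i)
glue-points P Q ls {X} shared {u} {w} u⊨ w⊨ agree = glue , glue-⊨ ls u⊨ w⊨ , glue-on-P
  where
  open Gluing P Q (lookup u) (lookup w)
                  (λ i∈P i∈Q → agree-on X u w agree (shared (x∈p∩q⁺ (i∈P , i∈Q))))

module _ {n} (P Q : Formula n) (ls : List (Literal n)) (X : Subset n)
             (shared : vars P ∩ vars Q ⊆ X) where

  private
    Pˡ Qˡ : Formula n
    Pˡ = P ++ lits ls
    Qˡ = Q ++ lits ls

  -- The model sets of P ∧ l⃗ and
  -- Q ∧ l⃗ cannot agree on X (they would glue), so some X′ separates them.
  cut-unsat : Unsatisfiable (P ++ Q ++ lits ls)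
    → Unsatisfiable (P ++ lits ls) ⊎ Unsatisfiable (Q ++ lits ls)
      ⊎ Σ (Subset n) (λ X′ → Σ Bool (λ p′ →
          X′ ⊆ X × (P ++ lits ls) Entails (X′ ≡ₓ p′) × (Q ++ lits ls) Entails (X′ ≡ₓ not p′)))
  cut-unsat unsat with anySubset? (models? Pˡ) | anySubset? (models? Qˡ)
  ... | no ∄a | _     = inj₁ (unsat-from-points Pˡ ∄a)
  ... | yes _ | no ∄b = inj₂ (inj₁ (unsat-from-points Qˡ ∄b))
  ... | yes (a₀ , a₀⊨) | yes (b₀ , b₀⊨)
    with agree-or-separated (Models Pˡ) (Models Qˡ) (models? Pˡ) (models? Qˡ)
                            (models-affine Pˡ) (models-affine Qˡ) X
  ...   | inj₁ (u , w , u⊨ , w⊨ , agree) with glue-points P Q ls shared u⊨ w⊨ agree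
  ...     | σ , σ⊨ , _ = ⊥-elim (unsat (σ , σ⊨))
  cut-unsat unsat | yes (a₀ , a₀⊨) | yes (b₀ , b₀⊨) | inj₂ (X′ , X′⊆X , separates)
    with separated-parities (Models Pˡ) (Models Qˡ) X′ a₀ b₀ separates a₀⊨ b₀⊨
  ... | on-Pˡ , on-Qˡ =
    inj₂ (inj₂ (X′ , X′ · a₀ , X′⊆X ,
                entails-from-points Pˡ X′ (X′ · a₀) on-Pˡ ,
                entails-from-points Qˡ X′ (not (X′ · a₀)) on-Qˡ))

  -- Here the separated sets are the models of
  -- P ∧ l⃗ ∧ (Y ≡ ¬p) and those of Q ∧ l⃗.
  cut-entails : (Y : Subset n) (p : Bool)
    → Satisfiable (P ++ Q ++ lits ls) → (P ++ Q ++ lits ls) Entails (Y ≡ₓ p) → Y ⊆ vars P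
    → (P ++ lits ls) Entails (Y ≡ₓ p)
      ⊎ Σ (Subset n) (λ X′ → Σ Bool (λ p′ →
          X′ ⊆ X × (Q ++ lits ls) Entails (X′ ≡ₓ p′)
                 × (P ++ lits ls ++ [ X′ ≡ₓ p′ ]) Entails (Y ≡ₓ p)))
  cut-entails Y p (σ₀ , σ₀⊨) entailed Y⊆P with anySubset? (models? (Pˡ ++ [ Y ≡ₓ not p ]))
  ... | no ∄a = inj₁ (entails-by-refutation Pˡ Y p λ {σ} σ⊨ Y-fails →
                        ∄a (tabulate σ , to-point (Pˡ ++ [ Y ≡ₓ not p ]) (++⁺ σ⊨ (Y-fails ∷ []))))
  ... | yes (a₀ , a₀⊨)
    with agree-or-separated (Models (Pˡ ++ [ Y ≡ₓ not p ])) (Models Qˡ)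
                            (models? (Pˡ ++ [ Y ≡ₓ not p ])) (models? Qˡ)
                            (models-affine (Pˡ ++ [ Y ≡ₓ not p ])) (models-affine Qˡ) X
  ...   | inj₁ (u , w , u⊨ , w⊨ , agree) with ++⁻ Pˡ u⊨
  ...     | u⊨Pˡ , (Y-fails ∷ []) with glue-points P Q ls shared u⊨Pˡ w⊨ agree
  ...       | σ , σ⊨ , σ≡u = ⊥-elim (not-¬ refl p≡not-p)
    where
    p≡not-p : p ≡ not p
    p≡not-p = trans (sym (entailed σ σ⊨)) (trans (xorSum-cong Y (λ i∈Y → σ≡u (Y⊆P i∈Y))) Y-fails)
  cut-entails Y p (σ₀ , σ₀⊨) entailed Y⊆P | yes (a₀ , a₀⊨) | inj₂ (X′ , X′⊆X , separates)
    with separated-parities (Models (Pˡ ++ [ Y ≡ₓ not p ])) (Models Qˡ) X′ a₀ (tabulate σ₀)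
                            separates a₀⊨ (to-point Qˡ (proj₂ (++⁻ P σ₀⊨)))
  ... | on-A , on-Qˡ =
    inj₂ (X′ , not (X′ · a₀) , X′⊆X ,
          entails-from-points Qˡ X′ (not (X′ · a₀)) on-Qˡ ,
          subst (_Entails (Y ≡ₓ p)) (++-assoc P (lits ls) [ X′ ≡ₓ not (X′ · a₀) ])
                (entails-by-refutation (Pˡ ++ [ X′ ≡ₓ not (X′ · a₀) ]) Y p refute))
    where
    -- A model of P ∧ l⃗ ∧ (Y ≡ ¬p) has the parity X′ · a₀ on X′, not its negation.
    refute : ∀ {σ} → σ ⊨ (Pˡ ++ [ X′ ≡ₓ not (X′ · a₀) ]) → ¬ (σ ⊨ᶜ (Y ≡ₓ not p))
    refute {σ} σ⊨ Y-fails with ++⁻ Pˡ σ⊨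
    ... | σ⊨Pˡ , (X′-parity ∷ []) =
      not-¬ (on-A (tabulate σ) (to-point (Pˡ ++ [ Y ≡ₓ not p ]) (++⁺ σ⊨Pˡ (Y-fails ∷ []))))
            (trans (·-tabulate X′ σ) X′-parity)

regroup : ∀ {n} {φ : Formula n} (P Q L : Formula n) → φ ↭ P ++ Q → φ ++ L ↭ P ++ Q ++ L
regroup P Q L φ↭PQ = ↭-trans (++⁺ʳ L φ↭PQ) (↭-reflexive (++-assoc P Q L))

sat-resp-↭ : ∀ {n} {ψ ψ′ : Formula n} → ψ ↭ ψ′ → Satisfiable ψ → Satisfiable ψ′
sat-resp-↭ ψ↭ψ′ (σ , σ⊨ψ) = σ , All-resp-↭ ψ↭ψ′ σ⊨ψ

unsat-resp-↭ : ∀ {n} {ψ ψ′ : Formula n} → ψ ↭ ψ′ → Unsatisfiable ψ → Unsatisfiable ψ′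
unsat-resp-↭ ψ↭ψ′ unsat sat = unsat (sat-resp-↭ (↭-sym ψ↭ψ′) sat)

entails-resp-↭ : ∀ {n} {ψ ψ′ : Formula n} (D : XorConstraint n)
  → ψ ↭ ψ′ → ψ Entails D → ψ′ Entails D
entails-resp-↭ D ψ↭ψ′ entailed σ σ⊨ψ′ = entailed σ (All-resp-↭ (↭-sym ψ↭ψ′) σ⊨ψ′)

-- The theorem: since φ ∧ l⃗ is Vᵃ ∧ Vᵇ ∧ l⃗ up to reordering, part (1) is
-- cut-unsat for (Vᵃ, Vᵇ) and part (2) is cut-entails for (φ^α, φ^β).
theorem6 : ∀ {n} (φ : Formula n) (X : Subset n) (Va Vb : Formula n)
    → X ⊆ vars φ
    → φ ↭ Va ++ Vb
    → vars Va ∩ vars Vb ≡ X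
    → (ls : List (Literal n))
    → All (λ l → proj₁ l ∈ vars φ) ls
    → (Unsatisfiable (φ ++ lits ls)
        → Unsatisfiable (Va ++ lits ls)
          ⊎ Unsatisfiable (Vb ++ lits ls)
          ⊎ Σ (Subset n) (λ X′ → Σ Bool (λ p′ →
              X′ ⊆ X
              × (Va ++ lits ls) Entails (X′ ≡ₓ p′)
              × (Vb ++ lits ls) Entails (X′ ≡ₓ not p′))))
      × (∀ (Y : Subset n) (p : Bool) (α : Side)
         → Satisfiable (φ ++ lits ls)
         → (φ ++ lits ls) Entails (Y ≡ₓ p)
         → Y ⊆ vars (part Va Vb α)
         → Y ∩ (vars (part Va Vb (other α)) ─ vars (part Va Vb α)) ≡ ⊥
         → (Va ++ lits ls) Entails (Y ≡ₓ p)
           ⊎ (Vb ++ lits ls) Entails (Y ≡ₓ p)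
           ⊎ Σ (Subset n) (λ X′ → Σ Bool (λ p′ → Σ Side (λ α′ →
               X′ ⊆ X
               × (part Va Vb α′ ++ lits ls) Entails (X′ ≡ₓ p′)
               × (part Va Vb (other α′) ++ lits ls ++ [ X′ ≡ₓ p′ ]) Entails (Y ≡ₓ p)))))
theorem6 φ X Va Vb _ φ↭VaVb cut ls _ =
  (λ unsat → cut-unsat Va Vb ls X (⊆-reflexive cut) (unsat-resp-↭ φ↭ab unsat)) ,
  λ { Y p a sat entailed Y⊆Va _ →
        [ inj₁ , (λ (X′ , p′ , cut-facts) → inj₂ (inj₂ (X′ , p′ , b , cut-facts))) ]′
          (cut-entails Va Vb ls X (⊆-reflexive cut) Y p
                       (sat-resp-↭ φ↭ab sat) (entails-resp-↭ (Y ≡ₓ p) φ↭ab entailed) Y⊆Va)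
    ; Y p b sat entailed Y⊆Vb _ →
        [ inj₂ ∘ inj₁ , (λ (X′ , p′ , cut-facts) → inj₂ (inj₂ (X′ , p′ , a , cut-facts))) ]′
          (cut-entails Vb Va ls X (⊆-reflexive (trans (∩-comm (vars Vb) (vars Va)) cut)) Y p
                       (sat-resp-↭ φ↭ba sat) (entails-resp-↭ (Y ≡ₓ p) φ↭ba entailed) Y⊆Vb) }
  where
  φ↭ab : φ ++ lits ls ↭ Va ++ Vb ++ lits ls
  φ↭ab = regroup Va Vb (lits ls) φ↭VaVb
  φ↭ba : φ ++ lits ls ↭ Vb ++ Va ++ lits ls
  φ↭ba = regroup Vb Va (lits ls) (↭-trans φ↭VaVb (++-comm Va Vb))
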